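{- Let $\langle\mathbf{A}_{\mathrm d},\mathbf{A},\iota\rangle$ be a (generalized) additive quantale with multiplication. Then an $\mathbf{A}$-module $\mathbf{P}$ is projective if and only if for every $\mathbf{A}$-module $\mathbf{Q}$, every pair of structural nuclei $\gamma$ on $\mathbf{P}$ and $\delta$ on $\mathbf{Q}$, and every embedding (injective homomorphism) of modules $f\colon\mathbf{P}_\gamma\hookrightarrow\mathbf{Q}_\delta$, there is a homomorphism of modules $\tau\colon\mathbf{P}\to\mathbf{Q}$ with $f\circ\gamma=\delta\circ\tau$.
   Context: Fix one of two parallel settings: plain ("joins" = joins of arbitrary families) or generalized ("joins" = joins of non-empty families). A (generalized) quantale is $\langle Q,\bigvee,+,\mathsf{0}\rangle$ with $Q$ a poset having all such joins, $\langle Q,+,\mathsf{0}\rangle$ a monoid with $+$ order-preserving and distributing over such joins on both sides. A (generalized) additive quantale with multiplication is a triple $\langle\mathbf{A}_{\mathrm d},\mathbf{A},\iota\rangle$: $\mathbf{A}_{\mathrm d}$ a monoid, $\mathbf{A}$ a (generalized) quantale with an additional monoid structure $\langle A,\cdot,\mathsf 1\rangle$, $\iota$ a monoid homomorphism, such that $(\bigvee_i a_i)\cdot b=\bigvee_i(a_i\cdot b)$, $(a+b)\cdot c=a\cdot c+b\cdot c$, $\mathsf0\cdot a=\mathsf0$, and for $d\in\mathbf{A}_{\mathrm d}$ left multiplication by $\iota(d)$ preserves joins, $+$, $\mathsf0$. An $\mathbf{A}$-module is a (generalized) quantale $\mathbf{Q}$ with $\ast\colon A\times Q\to Q$, order-preserving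 in both coordinates, with $(a\cdot b)\ast x=a\ast(b\ast x)$, $\mathsf1\ast x=x$, $(a+b)\ast x=a\ast x+b\ast x$, $\mathsf0\ast x=\mathsf0$, $(\bigvee_i a_i)\ast x=\bigvee_i(a_i\ast x)$, and $x\mapsto\iota(d)\ast x$ preserving $+$, $\mathsf0$, joins for $d\in\mathbf{A}_{\mathrm d}$; module homomorphisms are quantale homomorphisms $f$ with $f(a\ast x)=a\ast f(x)$. $\mathbf{P}$ is projective if for every surjective module homomorphism $g\colon\mathbf{R}\to\mathbf{S}$ and every module homomorphism $h\colon\mathbf{P}\to\mathbf{S}$ there is a module homomorphism $h'\colon\mathbf{P}\to\mathbf{R}$ with $g\circ h'=h$. A structural nucleus on a module $\mathbf{Q}$ is an order-preserving, expansive ($x\le\gamma(x)$), idempotent map $\gamma$ with $\gamma(x)+\gamma(y)\le\gamma(x+y)$ and $a\ast\gamma(x)\le\gamma(a\ast x)$ for all $a\in A$; $\mathbf{Q}_\gamma$ is the module on $\gamma[Q]$ with $\bigvee_\gamma X=\gamma(\bigvee X)$, $x+_\gamma y=\gamma(x+y)$, $\mathsf0_\gamma=\gamma(\mathsf0)$, $a\ast_\gamma x=\gamma(a\ast x)$, and $\gamma$ is regarded as a surjective module homomorphism $\mathbf{Q}\to\mathbf{Q}_\gamma$. -}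

module Defs where

open import Level using (Level; suc; _⊔_)
open import Data.Unit.Polymorphic using (⊤)
open import Data.Product using (Σ; _×_; _,_; proj₁; proj₂)
open import Function using (_∘_)
open import Relation.Binary.Bundles using (Poset)
open import Algebra.Bundles using (Monoid)
open import Algebra.Structures using (IsMonoid)

-- The two parallel settings.
--   plain       : joins of arbitrary families
--   generalized : joins of non-empty families
-- A family is indexed by a type I : Set c; in the generalized setting
-- it must come with a witness that I is inhabited.

data Setting : Set where
  plain generalized : Setting

Adm : ∀ {c} → Setting → Set c → Set c
Adm plain       I = ⊤
Adm generalized I = I

-- Raw module-like structures (carrier setoid, order and operations,
-- no laws).  Homomorphisms are defined on these, so that they apply
-- both to modules and to the nucleus images Q_γ.

record RawModule (s : Setting) {c : Level} (Scalar : Set c) : Set (suc c) where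
  infix  4 _≈_ _≤_
  infixl 6 _+_
  infixr 7 _∗_
  field
    Carrier : Set c
    _≈_     : Carrier → Carrier → Set c
    _≤_     : Carrier → Carrier → Set c
    ⋁       : {I : Set c} → Adm s I → (I → Carrier) → Carrier
    _+_     : Carrier → Carrier → Carrier
    𝟘       : Carrier
    _∗_     : Scalar → Carrier → Carrier

record Quantale (s : Setting) (c : Level) : Set (suc c) where
  infixl 6 _+_
  field
    poset : Poset c c c
  open Poset poset public
  field
    ⋁       : {I : Set c} → Adm s I → (I → Carrier) → Carrier
    ⋁-upper : {I : Set c} (p : Adm s I) (x : I → Carrier) (i : I) → x i ≤ ⋁ p x
    ⋁-least : {I : Set c} (p : Adm s I) (x : I → Carrier) (u : Carrier) →
              (∀ i → x i ≤ u) → ⋁ p x ≤ u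
    _+_       : Carrier → Carrier → Carrier
    𝟘         : Carrier
    +-isMonoid : IsMonoid _≈_ _+_ 𝟘
    +-mono    : ∀ {x x′ y y′} → x ≤ x′ → y ≤ y′ → x + y ≤ x′ + y′
    +-distribˡ-⋁ : {I : Set c} (p : Adm s I) (x : I → Carrier) (a : Carrier) →
                   a + ⋁ p x ≈ ⋁ p (λ i → a + x i)
    +-distribʳ-⋁ : {I : Set c} (p : Adm s I) (x : I → Carrier) (a : Carrier) →
                   ⋁ p x + a ≈ ⋁ p (λ i → x i + a)

record AddQuantaleMult (s : Setting) (c : Level) : Set (suc c) where
  field
    Ad : Monoid c c
    A  : Quantale s c
  module Ad = Monoid Ad
  open Quantale A public
  infixl 7 _·_
  field
    _·_ : Carrier → Carrier → Carrier
    𝟙   : Carrier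
    ·-isMonoid : IsMonoid _≈_ _·_ 𝟙
    ι      : Ad.Carrier → Carrier
    ι-cong : ∀ {d e} → d Ad.≈ e → ι d ≈ ι e
    ι-∙    : ∀ d e → ι (d Ad.∙ e) ≈ ι d · ι e
    ι-ε    : ι Ad.ε ≈ 𝟙
    ·-distribʳ-⋁ : {I : Set c} (p : Adm s I) (a : I → Carrier) (b : Carrier) →
                   ⋁ p a · b ≈ ⋁ p (λ i → a i · b)
    ·-distribʳ-+ : ∀ a b e → (a + b) · e ≈ a · e + b · e
    ·-zeroˡ      : ∀ a → 𝟘 · a ≈ 𝟘
    ι·-⋁ : ∀ d {I : Set c} (p : Adm s I) (a : I → Carrier) →
           ι d · ⋁ p a ≈ ⋁ p (λ i → ι d · a i)
    ι·-+ : ∀ d a b → ι d · (a + b) ≈ ι d · a + ι d · b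
    ι·-𝟘 : ∀ d → ι d · 𝟘 ≈ 𝟘

record Module {s : Setting} {c : Level} (𝔸 : AddQuantaleMult s c) : Set (suc c) where
  private module A = AddQuantaleMult 𝔸
  field
    Q : Quantale s c
  open Quantale Q public
  infixr 7 _∗_
  field
    _∗_     : A.Carrier → Carrier → Carrier
    ∗-mono  : ∀ {a b x y} → a A.≤ b → x ≤ y → a ∗ x ≤ b ∗ y
    ∗-assoc : ∀ a b x → (a A.· b) ∗ x ≈ a ∗ (b ∗ x)
    ∗-identity : ∀ x → A.𝟙 ∗ x ≈ x
    ∗-distribʳ-+ : ∀ a b x → (a A.+ b) ∗ x ≈ a ∗ x + b ∗ x
    ∗-zeroˡ : ∀ x → A.𝟘 ∗ x ≈ 𝟘
    ∗-distribʳ-⋁ : {I : Set c} (p : Adm s I) (a : I → A.Carrier) (x : Carrier) →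
                   A.⋁ p a ∗ x ≈ ⋁ p (λ i → a i ∗ x)
    ι∗-+ : ∀ d x y → A.ι d ∗ (x + y) ≈ A.ι d ∗ x + A.ι d ∗ y
    ι∗-𝟘 : ∀ d → A.ι d ∗ 𝟘 ≈ 𝟘
    ι∗-⋁ : ∀ d {I : Set c} (p : Adm s I) (x : I → Carrier) →
           A.ι d ∗ ⋁ p x ≈ ⋁ p (λ i → A.ι d ∗ x i)

  raw : RawModule s A.Carrier
  raw = record
    { Carrier = Carrier ; _≈_ = _≈_ ; _≤_ = _≤_ ; ⋁ = ⋁
    ; _+_ = _+_ ; 𝟘 = 𝟘 ; _∗_ = _∗_ }

module _ {s : Setting} {c : Level} {Scalar : Set c} where

  record IsHom (M N : RawModule s Scalar)
               (f : RawModule.Carrier M → RawModule.Carrier N) : Set (suc c) where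
    private
      module M = RawModule M
      module N = RawModule N
    field
      cong  : ∀ {x y} → x M.≈ y → f x N.≈ f y
      pres-⋁ : {I : Set c} (p : Adm s I) (x : I → M.Carrier) →
               f (M.⋁ p x) N.≈ N.⋁ p (f ∘ x)
      pres-+ : ∀ x y → f (x M.+ y) N.≈ f x N.+ f y
      pres-𝟘 : f M.𝟘 N.≈ N.𝟘
      pres-∗ : ∀ a x → f (a M.∗ x) N.≈ a N.∗ f x

  Injective : (M N : RawModule s Scalar) →
              (RawModule.Carrier M → RawModule.Carrier N) → Set c
  Injective M N f = ∀ {x y} → RawModule._≈_ N (f x) (f y) → RawModule._≈_ M x y

  Surjective : (M N : RawModule s Scalar) →
               (RawModule.Carrier M → RawModule.Carrier N) → Set c
  Surjective M N f = ∀ y → Σ (RawModule.Carrier M) (λ x → RawModule._≈_ N (f x) y)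

module _ {s : Setting} {c : Level} (𝔸 : AddQuantaleMult s c) where
  private module A = AddQuantaleMult 𝔸
  open Module using (raw)

  Projective : Module 𝔸 → Set (suc c)
  Projective P =
    (R S : Module 𝔸) (g : Module.Carrier R → Module.Carrier S) →
    IsHom (raw R) (raw S) g → Surjective (raw R) (raw S) g →
    (h : Module.Carrier P → Module.Carrier S) → IsHom (raw P) (raw S) h →
    Σ (Module.Carrier P → Module.Carrier R) λ h′ →
      IsHom (raw P) (raw R) h′ × (∀ x → Module._≈_ S (g (h′ x)) (h x))

  record IsStructuralNucleus (Q : Module 𝔸) (γ : Module.Carrier Q → Module.Carrier Q)
         : Set c where
    open Module Q
    field
      mono      : ∀ {x y} → x ≤ y → γ x ≤ γ y
      expansive : ∀ x → x ≤ γ x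
      idempotent : ∀ x → γ (γ x) ≈ γ x
      +-sub     : ∀ x y → γ x + γ y ≤ γ (x + y)
      ∗-sub     : ∀ a x → a ∗ γ x ≤ γ (a ∗ x)

  record StructuralNucleus (Q : Module 𝔸) : Set c where
    field
      γ          : Module.Carrier Q → Module.Carrier Q
      isNucleus  : IsStructuralNucleus Q γ
    open IsStructuralNucleus isNucleus public

  _/_ : (Q : Module 𝔸) → StructuralNucleus Q → RawModule s A.Carrier
  Q / N = record
    { Carrier = Σ Carrier (λ x → γ x ≈ x)
    ; _≈_ = λ x y → proj₁ x ≈ proj₁ y
    ; _≤_ = λ x y → proj₁ x ≤ proj₁ y
    ; ⋁   = λ p x → into (⋁ p (proj₁ ∘ x))
    ; _+_ = λ x y → into (proj₁ x + proj₁ y)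
    ; 𝟘   = into 𝟘
    ; _∗_ = λ a x → into (a ∗ proj₁ x)
    }
    where
      open Module Q
      open StructuralNucleus N
      into : Carrier → Σ Carrier (λ x → γ x ≈ x)
      into x = γ x , idempotent x

  toQuot : (Q : Module 𝔸) (N : StructuralNucleus Q) →
           Module.Carrier Q → RawModule.Carrier (Q / N)
  toQuot Q N x = StructuralNucleus.γ N x , StructuralNucleus.idempotent N x

-- (⇒) The image Q_δ is itself a module and δ : Q → Q_δ is a surjective
-- homomorphism, so projectivity of P lifts f ∘ γ : P → Q_δ along δ.
-- (⇐) Every homomorphism k : M → N has a kernel nucleus
-- κ x = ⋁ { y | k y ≤ k x }, and k restricted to M_κ is injective.  Given a
-- surjection g : R → S and h : P → S, choosing preimages under g and closing
-- them under the kernel nucleus of g gives an embedding P_{ker h} ↪ R_{ker g};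
-- the assumed lifting of this embedding is the required lifting of h.
module Submission where

open import Defs
open import Level using (Level; Lift; lift)
open import Data.Bool using (Bool; true; false)
open import Data.Product using (Σ; _×_; _,_; proj₁; proj₂)
open import Function using (_∘_)
open import Function.Bundles using (_⇔_; mk⇔)
open import Algebra.Structures using (IsMonoid)
open import Relation.Binary.Definitions using (Transitive)
open import Relation.Binary.Structures using (IsEquivalence)
import Relation.Binary.Reasoning.Setoid as SetoidReasoning

admissible : ∀ {c} (s : Setting) {I : Set c} → I → Adm s I
admissible plain       i = _
admissible generalized i = i

module QuantaleProperties {s : Setting} {c : Level} (Q : Quantale s c) where
  open Quantale Q

  ⋁-mono : {I : Set c} (p : Adm s I) {x y : I → Carrier} →
           (∀ i → x i ≤ y i) → ⋁ p x ≤ ⋁ p y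
  ⋁-mono p {x} {y} x≤y = ⋁-least p x (⋁ p y) (λ i → trans (x≤y i) (⋁-upper p y i))

  ⋁-cong : {I : Set c} (p : Adm s I) {x y : I → Carrier} →
           (∀ i → x i ≈ y i) → ⋁ p x ≈ ⋁ p y
  ⋁-cong p x≈y = antisym (⋁-mono p (λ i → reflexive (x≈y i)))
                         (⋁-mono p (λ i → reflexive (Eq.sym (x≈y i))))

  +-cong : ∀ {x x′ y y′} → x ≈ x′ → y ≈ y′ → x + y ≈ x′ + y′
  +-cong = IsMonoid.∙-cong +-isMonoid

module ModuleProperties {s : Setting} {c : Level} {𝔸 : AddQuantaleMult s c}
                        (M : Module 𝔸) where
  private module A = AddQuantaleMult 𝔸
  open Module M
  open QuantaleProperties Q public

  ∗-congʳ : ∀ {a x y} → x ≈ y → a ∗ x ≈ a ∗ y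
  ∗-congʳ x≈y = antisym (∗-mono A.refl (reflexive x≈y))
                        (∗-mono A.refl (reflexive (Eq.sym x≈y)))

∘-isHom : ∀ {s c} {Scalar : Set c} {L M N : RawModule s Scalar}
          {f : RawModule.Carrier L → RawModule.Carrier M}
          {g : RawModule.Carrier M → RawModule.Carrier N} →
          Transitive (RawModule._≈_ N) →
          IsHom M N g → IsHom L M f → IsHom L N (g ∘ f)
∘-isHom trans gH fH = record
  { cong   = g.cong ∘ f.cong
  ; pres-⋁ = λ p x → trans (g.cong (f.pres-⋁ p x)) (g.pres-⋁ p _)
  ; pres-+ = λ x y → trans (g.cong (f.pres-+ x y)) (g.pres-+ _ _)
  ; pres-𝟘 = trans (g.cong f.pres-𝟘) g.pres-𝟘
  ; pres-∗ = λ a x → trans (g.cong (f.pres-∗ a x)) (g.pres-∗ a _)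
  }
  where
    module f = IsHom fH
    module g = IsHom gH

module _ {s : Setting} {c : Level} (𝔸 : AddQuantaleMult s c) where
  private module A = AddQuantaleMult 𝔸
  open Module using (raw)

  isHom-resp-≈ : {M : RawModule s A.Carrier} (N : Module 𝔸)
                 {f g : RawModule.Carrier M → Module.Carrier N} →
                 (∀ x → Module._≈_ N (f x) (g x)) →
                 IsHom M (raw N) f → IsHom M (raw N) g
  isHom-resp-≈ N f≈g fH = record
    { cong   = λ x≈y → trans (sym (f≈g _)) (trans (f.cong x≈y) (f≈g _))
    ; pres-⋁ = λ p x → trans (sym (f≈g _)) (trans (f.pres-⋁ p x) (⋁-cong p (f≈g ∘ x)))
    ; pres-+ = λ x y → trans (sym (f≈g _)) (trans (f.pres-+ x y) (+-cong (f≈g x) (f≈g y)))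
    ; pres-𝟘 = trans (sym (f≈g _)) f.pres-𝟘
    ; pres-∗ = λ a x → trans (sym (f≈g _)) (trans (f.pres-∗ a x) (∗-congʳ (f≈g x)))
    }
    where
      open Module N using (module Eq)
      open Eq using (sym; trans)
      open ModuleProperties N
      module f = IsHom fH

  isHom⇒mono : (M N : Module 𝔸) {k : Module.Carrier M → Module.Carrier N} →
               IsHom (raw M) (raw N) k →
               ∀ {x y} → Module._≤_ M x y → Module._≤_ N (k x) (k y)
  isHom⇒mono M N {k} kH {x} {y} x≤y =
    N.trans (N.⋁-upper p (k ∘ pair) (lift true))
            (N.reflexive (N.Eq.trans (N.Eq.sym (pres-⋁ p pair)) (cong ⋁pair≈y)))
    where
      module M = Module M
      module N = Module N
      open IsHom kH
      pair : Lift c Bool → M.Carrier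
      pair (lift true)  = x
      pair (lift false) = y
      p : Adm s (Lift c Bool)
      p = admissible s (lift true)
      -- x ≤ y means x ∨ y ≈ y, and k preserves this binary join.
      ⋁pair≈y : M.⋁ p pair M.≈ y
      ⋁pair≈y = M.antisym
        (M.⋁-least p pair y (λ { (lift true) → x≤y ; (lift false) → M.refl }))
        (M.⋁-upper p pair (lift false))

  module StructuralNucleusProperties (M : Module 𝔸) (N : StructuralNucleus 𝔸 M) where
    open Module M hiding (Q; raw)
    open StructuralNucleus N
    open ModuleProperties M

    γ-cong : ∀ {x y} → x ≈ y → γ x ≈ γ y
    γ-cong x≈y = antisym (mono (reflexive x≈y)) (mono (reflexive (Eq.sym x≈y)))

    γ-least : ∀ {x y} → x ≤ y → γ y ≈ y → γ x ≤ y
    γ-least x≤y γy≈y = trans (mono x≤y) (reflexive γy≈y)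

    γ-absorbs-⋁ : {I : Set c} (p : Adm s I) (x : I → Carrier) → γ (⋁ p (γ ∘ x)) ≈ γ (⋁ p x)
    γ-absorbs-⋁ p x = antisym
      (γ-least (⋁-least p _ _ (λ i → mono (⋁-upper p x i))) (idempotent _))
      (mono (⋁-mono p (λ i → expansive (x i))))

    γ-absorbs-+ : ∀ x y → γ (γ x + γ y) ≈ γ (x + y)
    γ-absorbs-+ x y = antisym (γ-least (+-sub x y) (idempotent _))
                              (mono (+-mono (expansive x) (expansive y)))

    γ-absorbsˡ-+ : ∀ x y → γ x ≈ x → γ (x + γ y) ≈ γ (x + y)
    γ-absorbsˡ-+ x y γx≈x = Eq.trans (γ-cong (+-cong (Eq.sym γx≈x) Eq.refl)) (γ-absorbs-+ x y)

    γ-absorbsʳ-+ : ∀ x y → γ y ≈ y → γ (γ x + y) ≈ γ (x + y)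
    γ-absorbsʳ-+ x y γy≈y = Eq.trans (γ-cong (+-cong Eq.refl (Eq.sym γy≈y))) (γ-absorbs-+ x y)

    γ-absorbs-∗ : ∀ a x → γ (a ∗ γ x) ≈ γ (a ∗ x)
    γ-absorbs-∗ a x = antisym (γ-least (∗-sub a x) (idempotent _))
                              (mono (∗-mono A.refl (expansive x)))

    toQuot-isHom : IsHom (raw M) (_/_ 𝔸 M N) (toQuot 𝔸 M N)
    toQuot-isHom = record
      { cong   = γ-cong
      ; pres-⋁ = λ p x → Eq.sym (γ-absorbs-⋁ p x)
      ; pres-+ = λ x y → Eq.sym (γ-absorbs-+ x y)
      ; pres-𝟘 = Eq.refl
      ; pres-∗ = λ a x → Eq.sym (γ-absorbs-∗ a x)
      }

    toQuot-surjective : Surjective (raw M) (_/_ 𝔸 M N) (toQuot 𝔸 M N)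
    toQuot-surjective y = proj₁ y , proj₂ y

  _/ₘ_ : (M : Module 𝔸) → StructuralNucleus 𝔸 M → Module 𝔸
  M /ₘ N = record
    { Q = record
      { poset = record
        { Carrier = Fixed
        ; _≈_ = λ x y → proj₁ x ≈ proj₁ y
        ; _≤_ = λ x y → proj₁ x ≤ proj₁ y
        ; isPartialOrder = record
          { isPreorder = record
            { isEquivalence = ≈ᶠ-isEquivalence ; reflexive = reflexive ; trans = trans }
          ; antisym = antisym } }
      ; ⋁ = λ p x → into (⋁ p (proj₁ ∘ x))
      ; ⋁-upper = λ p x i → trans (⋁-upper p (proj₁ ∘ x) i) (expansive _)
      ; ⋁-least = λ p x u x≤u → γ-least (⋁-least p _ _ x≤u) (proj₂ u)
      ; _+_ = _⊕_
      ; 𝟘 = into 𝟘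
      ; +-isMonoid = ⊕-isMonoid
      ; +-mono = λ x≤x′ y≤y′ → mono (+-mono x≤x′ y≤y′)
      ; +-distribˡ-⋁ = λ p x a →
          Eq.trans (γ-absorbsˡ-+ (proj₁ a) _ (proj₂ a))
                   (Eq.trans (γ-cong (+-distribˡ-⋁ p (proj₁ ∘ x) (proj₁ a)))
                             (Eq.sym (γ-absorbs-⋁ p _)))
      ; +-distribʳ-⋁ = λ p x a →
          Eq.trans (γ-absorbsʳ-+ _ (proj₁ a) (proj₂ a))
                   (Eq.trans (γ-cong (+-distribʳ-⋁ p (proj₁ ∘ x) (proj₁ a)))
                             (Eq.sym (γ-absorbs-⋁ p _)))
      }
    ; _∗_ = λ a x → into (a ∗ proj₁ x)
    ; ∗-mono = λ a≤b x≤y → mono (∗-mono a≤b x≤y)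
    ; ∗-assoc = λ a b x → Eq.trans (γ-cong (∗-assoc a b _)) (Eq.sym (γ-absorbs-∗ a _))
    ; ∗-identity = λ x → Eq.trans (γ-cong (∗-identity _)) (proj₂ x)
    ; ∗-distribʳ-+ = λ a b x → Eq.trans (γ-cong (∗-distribʳ-+ a b _)) (Eq.sym (γ-absorbs-+ _ _))
    ; ∗-zeroˡ = λ x → γ-cong (∗-zeroˡ _)
    ; ∗-distribʳ-⋁ = λ p a x → Eq.trans (γ-cong (∗-distribʳ-⋁ p a _)) (Eq.sym (γ-absorbs-⋁ p _))
    ; ι∗-+ = λ d x y → Eq.trans (γ-absorbs-∗ _ _)
                         (Eq.trans (γ-cong (ι∗-+ d _ _)) (Eq.sym (γ-absorbs-+ _ _)))
    ; ι∗-𝟘 = λ d → Eq.trans (γ-absorbs-∗ _ _) (γ-cong (ι∗-𝟘 d))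
    ; ι∗-⋁ = λ d p x → Eq.trans (γ-absorbs-∗ _ _)
                         (Eq.trans (γ-cong (ι∗-⋁ d p _)) (Eq.sym (γ-absorbs-⋁ p _)))
    }
    where
      open Module M hiding (Q; raw)
      open StructuralNucleus N
      open StructuralNucleusProperties M N
      open ModuleProperties M using (+-cong)

      Fixed : Set c
      Fixed = Σ Carrier (λ x → γ x ≈ x)

      into : Carrier → Fixed
      into x = γ x , idempotent x

      _⊕_ : Fixed → Fixed → Fixed
      x ⊕ y = into (proj₁ x + proj₁ y)

      _≈ᶠ_ : Fixed → Fixed → Set c
      x ≈ᶠ y = proj₁ x ≈ proj₁ y

      ≈ᶠ-isEquivalence : IsEquivalence _≈ᶠ_
      ≈ᶠ-isEquivalence = record { refl = Eq.refl ; sym = Eq.sym ; trans = Eq.trans }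

      ⊕-isMonoid : IsMonoid _≈ᶠ_ _⊕_ (into 𝟘)
      ⊕-isMonoid = record
        { isSemigroup = record
          { isMagma = record
            { isEquivalence = ≈ᶠ-isEquivalence
            ; ∙-cong = λ x≈x′ y≈y′ → γ-cong (+-cong x≈x′ y≈y′) }
          ; assoc = λ x y z →
              Eq.trans (γ-absorbsʳ-+ (proj₁ x + proj₁ y) (proj₁ z) (proj₂ z))
                (Eq.trans (γ-cong (IsMonoid.assoc +-isMonoid _ _ _))
                          (Eq.sym (γ-absorbsˡ-+ (proj₁ x) (proj₁ y + proj₁ z) (proj₂ x)))) }
        ; identity =
            (λ x → Eq.trans (γ-absorbsʳ-+ 𝟘 (proj₁ x) (proj₂ x))
                     (Eq.trans (γ-cong (proj₁ (IsMonoid.identity +-isMonoid) _)) (proj₂ x)))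
          , (λ x → Eq.trans (γ-absorbsˡ-+ (proj₁ x) 𝟘 (proj₂ x))
                     (Eq.trans (γ-cong (proj₂ (IsMonoid.identity +-isMonoid) _)) (proj₂ x)))
        }

  injective-reflects-isHom : {X Y : RawModule s A.Carrier} (N : Module 𝔸)
    {e : RawModule.Carrier Y → Module.Carrier N} {φ : RawModule.Carrier X → RawModule.Carrier Y} →
    IsHom Y (raw N) e → Injective Y (raw N) e →
    IsHom X (raw N) (e ∘ φ) → IsHom X Y φ
  injective-reflects-isHom N eH e-inj eφH = record
    { cong   = e-inj ∘ eφ.cong
    ; pres-⋁ = λ p x → e-inj (trans (eφ.pres-⋁ p x) (sym (e.pres-⋁ p _)))
    ; pres-+ = λ x y → e-inj (trans (eφ.pres-+ x y) (sym (e.pres-+ _ _)))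
    ; pres-𝟘 = e-inj (trans eφ.pres-𝟘 (sym e.pres-𝟘))
    ; pres-∗ = λ a x → e-inj (trans (eφ.pres-∗ a x) (sym (e.pres-∗ a _)))
    }
    where
      open Module N using (module Eq)
      open Eq using (sym; trans)
      module e = IsHom eH
      module eφ = IsHom eφH

  module KernelNucleus (M N : Module 𝔸) {k : Module.Carrier M → Module.Carrier N}
                       (kH : IsHom (raw M) (raw N) k) where
    private
      module M = Module M
      module N = Module N
    open IsHom kH
    open ModuleProperties N using (+-cong; ∗-congʳ)

    κ : M.Carrier → M.Carrier
    κ x = M.⋁ (admissible s (x , N.refl)) (λ (y : Σ M.Carrier (λ y → k y N.≤ k x)) → proj₁ y)

    κ-upper : ∀ {x y} → k y N.≤ k x → y M.≤ κ x
    κ-upper {x} {y} ky≤kx = M.⋁-upper _ _ (y , ky≤kx)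

    κ-least : ∀ {x u} → (∀ y → k y N.≤ k x → y M.≤ u) → κ x M.≤ u
    κ-least {x} {u} below-u = M.⋁-least _ _ u (λ y → below-u (proj₁ y) (proj₂ y))

    k∘κ≈k : ∀ x → k (κ x) N.≈ k x
    k∘κ≈k x = N.antisym
      (N.trans (N.reflexive (pres-⋁ _ _)) (N.⋁-least _ _ _ proj₂))
      (N.trans (N.⋁-upper _ (k ∘ proj₁) (x , N.refl)) (N.reflexive (N.Eq.sym (pres-⋁ _ _))))

    κ-mono-k : ∀ {x y} → k x N.≤ k y → κ x M.≤ κ y
    κ-mono-k kx≤ky = κ-least (λ z kz≤kx → κ-upper (N.trans kz≤kx kx≤ky))

    κ-cong-k : ∀ {x y} → k x N.≈ k y → κ x M.≈ κ y
    κ-cong-k kx≈ky = M.antisym (κ-mono-k (N.reflexive kx≈ky))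
                               (κ-mono-k (N.reflexive (N.Eq.sym kx≈ky)))

    kernelNucleus : StructuralNucleus 𝔸 M
    kernelNucleus = record
      { γ = κ
      ; isNucleus = record
        { mono       = κ-mono-k ∘ isHom⇒mono M N kH
        ; expansive  = λ x → κ-upper N.refl
        ; idempotent = λ x → κ-cong-k (k∘κ≈k x)
        ; +-sub      = λ x y → κ-upper (N.reflexive (N.Eq.trans (pres-+ _ _)
            (N.Eq.trans (+-cong (k∘κ≈k x) (k∘κ≈k y)) (N.Eq.sym (pres-+ x y)))))
        ; ∗-sub      = λ a x → κ-upper (N.reflexive (N.Eq.trans (pres-∗ a _)
            (N.Eq.trans (∗-congʳ (k∘κ≈k x)) (N.Eq.sym (pres-∗ a x)))))
        }
      }

    M/ker : RawModule s A.Carrier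
    M/ker = _/_ 𝔸 M kernelNucleus

    induced-isHom : IsHom M/ker (raw N) (k ∘ proj₁)
    induced-isHom = record
      { cong   = cong
      ; pres-⋁ = λ p x → N.Eq.trans (k∘κ≈k _) (pres-⋁ p _)
      ; pres-+ = λ x y → N.Eq.trans (k∘κ≈k _) (pres-+ _ _)
      ; pres-𝟘 = N.Eq.trans (k∘κ≈k _) pres-𝟘
      ; pres-∗ = λ a x → N.Eq.trans (k∘κ≈k _) (pres-∗ a _)
      }

    induced-injective : Injective M/ker (raw N) (k ∘ proj₁)
    induced-injective {u , κu≈u} {v , κv≈v} ku≈kv =
      M.Eq.trans (M.Eq.sym κu≈u) (M.Eq.trans (κ-cong-k ku≈kv) κv≈v)

  HasNucleusLifting : Module 𝔸 → Set (Level.suc c)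
  HasNucleusLifting P =
    (Q : Module 𝔸) (γ : StructuralNucleus 𝔸 P) (δ : StructuralNucleus 𝔸 Q)
    (f : RawModule.Carrier (_/_ 𝔸 P γ) → RawModule.Carrier (_/_ 𝔸 Q δ)) →
    IsHom (_/_ 𝔸 P γ) (_/_ 𝔸 Q δ) f → Injective (_/_ 𝔸 P γ) (_/_ 𝔸 Q δ) f →
    Σ (Module.Carrier P → Module.Carrier Q) λ τ →
      IsHom (raw P) (raw Q) τ ×
      (∀ x → RawModule._≈_ (_/_ 𝔸 Q δ) (f (toQuot 𝔸 P γ x)) (toQuot 𝔸 Q δ (τ x)))

  projective⇒hasNucleusLifting : (P : Module 𝔸) → Projective 𝔸 P → HasNucleusLifting P
  projective⇒hasNucleusLifting P projective Q γ δ f fH _ =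
    let τ , τH , δτ≈fγ = projective Q (Q /ₘ δ) (toQuot 𝔸 Q δ) δ.toQuot-isHom δ.toQuot-surjective
                                   (f ∘ toQuot 𝔸 P γ) fγH
    in τ , τH , λ x → Module.Eq.sym Q (δτ≈fγ x)
    where
      module γ = StructuralNucleusProperties P γ
      module δ = StructuralNucleusProperties Q δ
      fγH : IsHom (raw P) (raw (Q /ₘ δ)) (f ∘ toQuot 𝔸 P γ)
      fγH = ∘-isHom (Module.Eq.trans Q) fH γ.toQuot-isHom

  hasNucleusLifting⇒projective : (P : Module 𝔸) → HasNucleusLifting P → Projective 𝔸 P
  hasNucleusLifting⇒projective P lifting R S g gH g-surjective h hH =
    let τ , τH , fγ≈δτ = lifting R h.kernelNucleus g.kernelNucleus f fH
                                 (λ {x} {y} → f-injective {x} {y})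
    in τ , τH , λ x → lifting⇒g≈h x (τ x) (fγ≈δτ x)
    where
      module R = Module R
      module S = Module S
      module g = KernelNucleus R S gH
      module h = KernelNucleus P S hH

      f : RawModule.Carrier h.M/ker → RawModule.Carrier g.M/ker
      f x = toQuot 𝔸 R g.kernelNucleus (proj₁ (g-surjective (h (proj₁ x))))

      gf≈h : ∀ x → g (proj₁ (f x)) S.≈ h (proj₁ x)
      gf≈h x = S.Eq.trans (g.k∘κ≈k _) (proj₂ (g-surjective (h (proj₁ x))))

      fH : IsHom h.M/ker g.M/ker f
      fH = injective-reflects-isHom S g.induced-isHom (λ {x} {y} → g.induced-injective {x} {y})
             (isHom-resp-≈ S (λ x → S.Eq.sym (gf≈h x)) h.induced-isHom)

      f-injective : Injective h.M/ker g.M/ker f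
      f-injective {x} {y} fx≈fy = h.induced-injective {x} {y}
        (S.Eq.trans (S.Eq.sym (gf≈h x)) (S.Eq.trans (IsHom.cong gH fx≈fy) (gf≈h y)))

      lifting⇒g≈h : ∀ x t → proj₁ (f (toQuot 𝔸 P h.kernelNucleus x)) R.≈ g.κ t → g t S.≈ h x
      lifting⇒g≈h x t fx≈κt = begin
        g t                                     ≈⟨ g.k∘κ≈k t ⟨
        g (g.κ t)                               ≈⟨ IsHom.cong gH fx≈κt ⟨
        g (proj₁ (f (toQuot 𝔸 P h.kernelNucleus x))) ≈⟨ gf≈h (toQuot 𝔸 P h.kernelNucleus x) ⟩
        h (h.κ x)                               ≈⟨ h.k∘κ≈k x ⟩
        h x                                     ∎
        where open SetoidReasoning S.Eq.setoid

theorem7p1 : {s : Setting} {c : Level} (𝔸 : AddQuantaleMult s c) (P : Module 𝔸) →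
    Projective 𝔸 P ⇔
    ((Q : Module 𝔸) (γ : StructuralNucleus 𝔸 P) (δ : StructuralNucleus 𝔸 Q)
     (f : RawModule.Carrier (_/_ 𝔸 P γ) → RawModule.Carrier (_/_ 𝔸 Q δ)) →
     IsHom (_/_ 𝔸 P γ) (_/_ 𝔸 Q δ) f → Injective (_/_ 𝔸 P γ) (_/_ 𝔸 Q δ) f →
     Σ (Module.Carrier P → Module.Carrier Q) λ τ →
       IsHom (Module.raw P) (Module.raw Q) τ ×
       (∀ x → RawModule._≈_ (_/_ 𝔸 Q δ) (f (toQuot 𝔸 P γ x)) (toQuot 𝔸 Q δ (τ x))))
theorem7p1 𝔸 P = mk⇔ (projective⇒hasNucleusLifting 𝔸 P) (hasNucleusLifting⇒projective 𝔸 P)
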